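{- Let $n\ge2$ and $1\le m\le\binom n2$, let $G$ be a graph chosen uniformly at random among all graphs on $n$ labelled vertices with exactly $m$ edges ($G\in G(n,m)$), and let $B$ be a uniformly random ordering of $E(G)$. Then \[ \mathbb{E}(\kappa(G,B))=\frac{\binom n2}{2n-3}\left(1-\frac{\binom{\binom n2-m}{2n-3}}{\binom{\binom n2}{2n-3}}\right), \] the expectation being over both $G$ and $B$.
   Context: For an ordering $B=(e_1,\dots,e_m)$ of the edges of a finite simple graph $G$, run the forest building process: start with no edges on $V(G)$ and for $j=1,\dots,m$ keep $e_j$ if and only if $e_j$ is incident to a vertex not incident to any $e_i$ with $i<j$. $\kappa(G,B)$ denotes the number of connected components of the resulting forest that contain at least one edge (isolated vertices of $G$ are not counted). -}

module Defs where

open import Data.Nat using (ℕ; zero; suc; _+_; _*_; _∸_; _<?_)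
open import Data.Nat.Combinatorics using (_C_)
open import Data.Bool using (Bool; true; false; _∧_; _∨_; not; if_then_else_)
open import Data.Fin using (Fin; toℕ) renaming (_≟_ to _≟ᶠ_)
open import Data.List using (List; []; _∷_; [_]; map; _++_; concatMap; filter; length; allFin; cartesianProduct; foldl)
open import Data.Bool.ListAction using (any)
open import Data.Nat.ListAction using (sum)
open import Data.Product using (_×_; _,_; proj₁; proj₂)
open import Relation.Nullary.Decidable using (does)
open import Relation.Nullary.Decidable using (T?)

-- An edge of the complete graph K_n on vertex set Fin n: a pair (i , j) with i < j.
Edge : ℕ → Set
Edge n = Fin n × Fin n

allEdges : (n : ℕ) → List (Edge n)
allEdges n = filter (λ e → toℕ (proj₁ e) <? toℕ (proj₂ e)) (cartesianProduct (allFin n) (allFin n))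

choose : {A : Set} → ℕ → List A → List (List A)
choose zero    _        = [ [] ]
choose (suc k) []       = []
choose (suc k) (x ∷ xs) = map (x ∷_) (choose k xs) ++ choose (suc k) xs

insertions : {A : Set} → A → List A → List (List A)
insertions x []       = [ x ∷ [] ]
insertions x (y ∷ ys) = (x ∷ y ∷ ys) ∷ map (y ∷_) (insertions x ys)

perms : {A : Set} → List A → List (List A)
perms []       = [ [] ]
perms (x ∷ xs) = concatMap (insertions x) (perms xs)

_==_ : {n : ℕ} → Fin n → Fin n → Bool
a == b = does (a ≟ᶠ b)

-- State of the forest building process:
--   covered v  : whether v is incident to an already kept edge,
--   label v    : component label of v in the forest of kept edges
--                (two vertices have equal labels iff they are connected
--                 in the forest built so far).
record State (n : ℕ) : Set where
  constructor st
  field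
    covered : Fin n → Bool
    label   : Fin n → Fin n
open State public

initState : (n : ℕ) → State n
initState n = st (λ _ → false) (λ v → v)

step : {n : ℕ} → State n → Edge n → State n
step s (u , v) =
  if not (covered s u ∧ covered s v)
  then st (λ w → covered s w ∨ (w == u) ∨ (w == v))
          (λ w → if label s w == label s v then label s u else label s w)
  else s

runForest : {n : ℕ} → List (Edge n) → State n
runForest {n} B = foldl step (initState n) B

-- κ(G,B): number of connected components of the resulting forest containing
-- at least one edge = number of distinct labels carried by covered vertices.
κ : {n : ℕ} → List (Edge n) → ℕ
κ {n} B = length (filter (λ x → T? (any (λ w → covered s w ∧ (label s w == x)) (allFin n))) (allFin n))
  where
    s = runForest B

-- The probability space: all pairs (G , B) where G is a graph on Fin n with
-- exactly m edges (an m-subset of the edges of K_n) and B an ordering of E(G).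
-- Each pair is uniformly likely (G uniform in G(n,m), B uniform given G).
outcomes : (n m : ℕ) → List (List (Edge n))
outcomes n m = concatMap perms (choose m (allEdges n))

numOutcomes : (n m : ℕ) → ℕ
numOutcomes n m = length (outcomes n m)

-- Sum of κ(G,B) over all outcomes; E(κ) = sumκ n m / numOutcomes n m.
sumκ : (n m : ℕ) → ℕ
sumκ n m = sum (map κ (outcomes n m))

-- Appending an edge y to an ordering B raises κ by one if y meets no edge of B and leaves it
-- unchanged otherwise. Splitting every ordering at its last edge therefore gives, for the total
-- S(m) of κ over all outcomes (G , B) with |G| = m,
--   S(m+1) = (N − m) S(m) + N m! C(N − k, m),   where N = C(n, 2) and k = 2n − 3
-- is the number of edges meeting a given edge, itself included. Induction on m with the
-- absorption identity gives k S(m) = N m! (C(N, m) − C(N − k, m)); as there are C(N, m) m!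
-- outcomes, C(N − k, m) C(N, k) = C(N, m) C(N − m, k) turns this into the stated formula.

module Submission where

open import Data.Bool using (Bool; true; false; not; _∧_; _∨_; if_then_else_)
open import Data.Bool.ListAction using (any)
open import Data.Bool.Properties using (∨-assoc; ∨-comm; ∨-zeroʳ; ∨-identityʳ; if-eta)
open import Data.Empty using (⊥-elim)
open import Data.Fin using (Fin; zero; suc; toℕ)
import Data.Fin.Properties as Fin
open import Data.List using (List; []; _∷_; [_]; _++_; map; concatMap; filter; length; allFin; cartesianProduct; foldl)
open import Data.List.Membership.Propositional using (_∈_)
open import Data.List.Membership.Propositional.Properties using (∈-allFin)
open import Data.List.Properties using (length-++; length-map; map-tabulate; foldl-++; length-tabulate)
import Data.List.Relation.Binary.Permutation.Propositional as ↭
open ↭ using (_↭_; ↭-refl; ↭-prep; ↭-swap; ↭-trans; ↭-sym)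
open import Data.List.Relation.Binary.Permutation.Propositional.Properties using (↭-length; All-resp-↭)
  renaming (map⁺ to ↭-map⁺)
open import Data.List.Relation.Unary.All as All using (All; []; _∷_)
open import Data.List.Relation.Unary.All.Properties using (++⁺; map⁺; concat⁺; all-filter)
open import Data.List.Relation.Unary.Any using (here; there)
open import Data.Nat using (ℕ; zero; suc; _+_; _*_; _∸_; _≤_; _<_; _≤?_; _<?_; _!; s≤s)
open import Data.Nat.Combinatorics using (_C_; nCk+nC[k+1]≡[n+1]C[k+1]; nC1≡n; k>n⇒nCk≡0; nCk≡n!/k![n-k]!; k![n∸k]!∣n!)
open import Data.Nat.DivMod using (m/n*n≡m)
open import Data.Nat.ListAction using (sum)
open import Data.Nat.ListAction.Properties using (sum-↭)
open import Data.Nat.Properties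
open import Data.Nat.Tactic.RingSolver using (solve-∀)
open import Data.Product using (_×_; _,_; proj₁; proj₂; map₂; Σ)
open import Data.Sum using (_⊎_; inj₁; inj₂)
open import Function using (_∘_)
open import Level using (0ℓ)
open import Relation.Binary.PropositionalEquality using (_≡_; _≢_; refl; sym; trans; cong; cong₂; subst; module ≡-Reasoning)
open import Relation.Nullary using (¬_; yes; no)
open import Relation.Nullary.Decidable using (does; dec-true; dec-false)
open import Relation.Unary using (Pred; Decidable)
open ≡-Reasoning

open import Defs

private variable
  A B : Set

-- Sums over lists

∑ : List A → (A → ℕ) → ℕ
∑ []       f = 0
∑ (x ∷ xs) f = f x + ∑ xs f

syntax ∑ xs (λ x → e) = ∑[ x ∈ xs ] e

𝟙 : Bool → ℕ
𝟙 b = if b then 1 else 0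

sum-map : (f : A → ℕ) (xs : List A) → sum (map f xs) ≡ ∑ xs f
sum-map f []       = refl
sum-map f (x ∷ xs) = cong (f x +_) (sum-map f xs)

∑-++ : (f : A → ℕ) (xs ys : List A) → ∑ (xs ++ ys) f ≡ ∑ xs f + ∑ ys f
∑-++ f []       ys = refl
∑-++ f (x ∷ xs) ys = trans (cong (f x +_) (∑-++ f xs ys)) (sym (+-assoc (f x) _ _))

∑-map : (f : B → ℕ) (g : A → B) (xs : List A) → ∑ (map g xs) f ≡ ∑[ x ∈ xs ] f (g x)
∑-map f g []       = refl
∑-map f g (x ∷ xs) = cong (f (g x) +_) (∑-map f g xs)

∑-concatMap : (f : B → ℕ) (g : A → List B) (xs : List A) →
              ∑ (concatMap g xs) f ≡ ∑[ x ∈ xs ] ∑ (g x) f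
∑-concatMap f g []       = refl
∑-concatMap f g (x ∷ xs) = trans (∑-++ f (g x) _) (cong (∑ (g x) f +_) (∑-concatMap f g xs))

∑-cong : {f g : A → ℕ} (xs : List A) → (∀ x → f x ≡ g x) → ∑ xs f ≡ ∑ xs g
∑-cong []       f≗g = refl
∑-cong (x ∷ xs) f≗g = cong₂ _+_ (f≗g x) (∑-cong xs f≗g)

∑-congᴬ : {f g : A → ℕ} {xs : List A} → All (λ x → f x ≡ g x) xs → ∑ xs f ≡ ∑ xs g
∑-congᴬ []           = refl
∑-congᴬ (fx≡gx ∷ eqs) = cong₂ _+_ fx≡gx (∑-congᴬ eqs)

∑-+ : (f g : A → ℕ) (xs : List A) → ∑[ x ∈ xs ] (f x + g x) ≡ ∑ xs f + ∑ xs g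
∑-+ f g []       = refl
∑-+ f g (x ∷ xs) = trans (cong (f x + g x +_) (∑-+ f g xs)) (+-+-swap (f x) (g x) _ _)
  where
  +-+-swap : ∀ a b c d → a + b + (c + d) ≡ a + c + (b + d)
  +-+-swap = solve-∀

∑-*ˡ : (c : ℕ) (f : A → ℕ) (xs : List A) → ∑[ x ∈ xs ] (c * f x) ≡ c * ∑ xs f
∑-*ˡ c f []       = sym (*-zeroʳ c)
∑-*ˡ c f (x ∷ xs) = trans (cong (c * f x +_) (∑-*ˡ c f xs)) (sym (*-distribˡ-+ c (f x) _))

∑-const : (c : ℕ) (xs : List A) → ∑ xs (λ _ → c) ≡ length xs * c
∑-const c []       = refl
∑-const c (x ∷ xs) = cong (c +_) (∑-const c xs)

∑-zero : (xs : List A) → ∑ xs (λ _ → 0) ≡ 0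
∑-zero xs = trans (∑-const 0 xs) (*-zeroʳ (length xs))

∑-constᴬ : {f : A → ℕ} (c : ℕ) {xs : List A} → All (λ x → f x ≡ c) xs → ∑ xs f ≡ length xs * c
∑-constᴬ c {xs} f≡c = trans (∑-congᴬ f≡c) (∑-const c xs)

∑-↭ : (f : A → ℕ) {xs ys : List A} → xs ↭ ys → ∑ xs f ≡ ∑ ys f
∑-↭ f {xs} {ys} xs↭ys = begin
  ∑ xs f           ≡⟨ sum-map f xs ⟨
  sum (map f xs)   ≡⟨ sum-↭ (↭-map⁺ f xs↭ys) ⟩
  sum (map f ys)   ≡⟨ sum-map f ys ⟩
  ∑ ys f           ∎

∑-𝟙-split : (q : A → Bool) (xs : List A) → ∑[ x ∈ xs ] 𝟙 (q x) + ∑[ x ∈ xs ] 𝟙 (not (q x)) ≡ length xs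
∑-𝟙-split q []       = refl
∑-𝟙-split q (x ∷ xs) with q x
... | true  = cong suc (∑-𝟙-split q xs)
... | false = trans (+-suc _ _) (cong suc (∑-𝟙-split q xs))

∑-filter : {P : Pred A 0ℓ} (P? : Decidable P) (f : A → ℕ) (xs : List A) →
           ∑ (filter P? xs) f ≡ ∑[ x ∈ xs ] (if does (P? x) then f x else 0)
∑-filter P? f []       = refl
∑-filter P? f (x ∷ xs) with does (P? x)
... | true  = cong (f x +_) (∑-filter P? f xs)
... | false = ∑-filter P? f xs

∑-cartesianProduct : (f : A × B → ℕ) (xs : List A) (ys : List B) →
                     ∑ (cartesianProduct xs ys) f ≡ ∑[ x ∈ xs ] ∑[ y ∈ ys ] f (x , y)
∑-cartesianProduct f []       ys = refl
∑-cartesianProduct f (x ∷ xs) ys = begin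
  ∑ (map (x ,_) ys ++ cartesianProduct xs ys) f               ≡⟨ ∑-++ f (map (x ,_) ys) _ ⟩
  ∑ (map (x ,_) ys) f + ∑ (cartesianProduct xs ys) f          ≡⟨ cong₂ _+_ (∑-map f (x ,_) ys) (∑-cartesianProduct f xs ys) ⟩
  ∑[ y ∈ ys ] f (x , y) + ∑[ x′ ∈ xs ] ∑[ y ∈ ys ] f (x′ , y) ∎

∑-allFin-suc : ∀ {n} (f : Fin (suc n) → ℕ) → ∑ (allFin (suc n)) f ≡ f zero + ∑[ i ∈ allFin n ] f (suc i)
∑-allFin-suc {n} f = cong (f zero +_) (trans (cong (λ xs → ∑ xs f) (sym (map-tabulate (λ i → i) suc))) (∑-map f suc (allFin n)))

length-concatMap : (g : A → List B) (xs : List A) → length (concatMap g xs) ≡ ∑[ x ∈ xs ] length (g x)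
length-concatMap g []       = refl
length-concatMap g (x ∷ xs) = trans (length-++ (g x)) (cong (length (g x) +_) (length-concatMap g xs))

length-filter : {P : Pred A 0ℓ} (P? : Decidable P) (xs : List A) → length (filter P? xs) ≡ ∑[ x ∈ xs ] 𝟙 (does (P? x))
length-filter P? []       = refl
length-filter P? (x ∷ xs) with does (P? x)
... | true  = cong suc (length-filter P? xs)
... | false = length-filter P? xs

-- Orderings and subsets of a list

any-↭ : (p : A → Bool) {xs ys : List A} → xs ↭ ys → any p xs ≡ any p ys
any-↭ p ↭.refl                        = refl
any-↭ p (↭.prep x xs↭ys)              = cong (p x ∨_) (any-↭ p xs↭ys)
any-↭ p (↭.swap {xs} {ys} x y xs↭ys) = begin
  p x ∨ (p y ∨ any p xs) ≡⟨ ∨-assoc (p x) (p y) _ ⟨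
  (p x ∨ p y) ∨ any p xs ≡⟨ cong₂ _∨_ (∨-comm (p x) (p y)) (any-↭ p xs↭ys) ⟩
  (p y ∨ p x) ∨ any p ys ≡⟨ ∨-assoc (p y) (p x) _ ⟩
  p y ∨ (p x ∨ any p ys) ∎
any-↭ p (↭.trans xs↭ys ys↭zs)         = trans (any-↭ p xs↭ys) (any-↭ p ys↭zs)

any-∨ : (p q : A → Bool) (xs : List A) → any (λ x → p x ∨ q x) xs ≡ (any p xs ∨ any q xs)
any-∨ p q []       = refl
any-∨ p q (x ∷ xs) with p x | q x
... | true  | _     = refl
... | false | true  = sym (∨-zeroʳ (any p xs))
... | false | false = any-∨ p q xs

any-intro : (p : A → Bool) {x : A} {xs : List A} → x ∈ xs → p x ≡ true → any p xs ≡ true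
any-intro p {xs = y ∷ ys} (here refl) px = cong (_∨ any p ys) px
any-intro p {xs = y ∷ ys} (there x∈ys) px = trans (cong (p y ∨_) (any-intro p x∈ys px)) (∨-zeroʳ (p y))

any-elim : (p : A → Bool) (xs : List A) → any p xs ≡ true → Σ A (λ x → p x ≡ true)
any-elim p (x ∷ xs) any≡true with p x in px
... | true  = x , px
... | false = any-elim p xs any≡true

insertions-↭ : (x : A) (xs : List A) → All (_↭ x ∷ xs) (insertions x xs)
insertions-↭ x []       = ↭-refl ∷ []
insertions-↭ x (y ∷ ys) =
  ↭-refl ∷ map⁺ (All.map (λ D↭x∷ys → ↭-trans (↭-prep y D↭x∷ys) (↭-swap y x ↭-refl)) (insertions-↭ x ys))

perms-↭ : (xs : List A) → All (_↭ xs) (perms xs)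
perms-↭ []       = ↭-refl ∷ []
perms-↭ (x ∷ xs) = concat⁺ (map⁺ (All.map
  (λ {ys} ys↭xs → All.map (λ D↭x∷ys → ↭-trans D↭x∷ys (↭-prep x ys↭xs)) (insertions-↭ x ys))
  (perms-↭ xs)))

length-insertions : (x : A) (xs : List A) → length (insertions x xs) ≡ suc (length xs)
length-insertions x []       = refl
length-insertions x (y ∷ ys) = cong suc (trans (length-map (y ∷_) (insertions x ys)) (length-insertions x ys))

length-perms : (xs : List A) → length (perms xs) ≡ length xs !
length-perms []       = refl
length-perms (x ∷ xs) = begin
  length (concatMap (insertions x) (perms xs))      ≡⟨ length-concatMap (insertions x) (perms xs) ⟩
  ∑[ ys ∈ perms xs ] length (insertions x ys)        ≡⟨ ∑-constᴬ (suc (length xs)) (All.map length-ins (perms-↭ xs)) ⟩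
  length (perms xs) * suc (length xs)               ≡⟨ cong (_* suc (length xs)) (length-perms xs) ⟩
  length xs ! * suc (length xs)                     ≡⟨ *-comm (length xs !) (suc (length xs)) ⟩
  suc (length xs) !                                 ∎
  where
  length-ins : ∀ {ys} → ys ↭ xs → length (insertions x ys) ≡ suc (length xs)
  length-ins {ys} ys↭xs = trans (length-insertions x ys) (cong suc (↭-length ys↭xs))

length-choose : (m : ℕ) (xs : List A) → length (choose m xs) ≡ length xs C m
length-choose zero    xs       = refl
length-choose (suc m) []       = refl
length-choose (suc m) (x ∷ xs) = begin
  length (map (x ∷_) (choose m xs) ++ choose (suc m) xs)   ≡⟨ length-++ (map (x ∷_) (choose m xs)) ⟩
  length (map (x ∷_) (choose m xs)) + length (choose (suc m) xs)
    ≡⟨ cong₂ _+_ (trans (length-map (x ∷_) (choose m xs)) (length-choose m xs)) (length-choose (suc m) xs) ⟩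
  length xs C m + length xs C suc m                         ≡⟨ nCk+nC[k+1]≡[n+1]C[k+1] (length xs) m ⟩
  suc (length xs) C suc m                                   ∎

choose-length : (m : ℕ) (xs : List A) → All (λ ys → length ys ≡ m) (choose m xs)
choose-length zero    xs       = refl ∷ []
choose-length (suc m) []       = []
choose-length (suc m) (x ∷ xs) = ++⁺ (map⁺ (All.map (cong suc) (choose-length m xs))) (choose-length (suc m) xs)

length-orderings : (E : List A) (m : ℕ) → length (concatMap perms (choose m E)) ≡ (length E C m) * m !
length-orderings E m = begin
  length (concatMap perms (choose m E))    ≡⟨ length-concatMap perms (choose m E) ⟩
  ∑[ G ∈ choose m E ] length (perms G)     ≡⟨ ∑-constᴬ (m !) (All.map (λ {G} |G|≡m → trans (length-perms G) (cong _! |G|≡m)) (choose-length m E)) ⟩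
  length (choose m E) * m !                ≡⟨ cong (_* m !) (length-choose m E) ⟩
  (length E C m) * m !                     ∎

∑-choose-∷ : (f : List A → ℕ) (m : ℕ) (x : A) (xs : List A) →
  ∑ (choose (suc m) (x ∷ xs)) f ≡ ∑[ ys ∈ choose m xs ] f (x ∷ ys) + ∑ (choose (suc m) xs) f
∑-choose-∷ f m x xs =
  trans (∑-++ f (map (x ∷_) (choose m xs)) _) (cong (_+ ∑ (choose (suc m) xs) f) (∑-map f (x ∷_) (choose m xs)))

∑-choose-avoiding : (p : A → Bool) (m : ℕ) (xs : List A) →
  ∑[ ys ∈ choose m xs ] 𝟙 (not (any p ys)) ≡ (∑[ x ∈ xs ] 𝟙 (not (p x))) C m
∑-choose-avoiding p zero    xs       = refl
∑-choose-avoiding p (suc m) []       = refl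
∑-choose-avoiding p (suc m) (x ∷ xs) = begin
  ∑ (choose (suc m) (x ∷ xs)) avoids
    ≡⟨ ∑-choose-∷ avoids m x xs ⟩
  ∑[ ys ∈ choose m xs ] avoids (x ∷ ys) + ∑ (choose (suc m) xs) avoids
    ≡⟨ cong (∑[ ys ∈ choose m xs ] avoids (x ∷ ys) +_) (∑-choose-avoiding p (suc m) xs) ⟩
  ∑[ ys ∈ choose m xs ] 𝟙 (not (p x ∨ any p ys)) + c C suc m
    ≡⟨ by-head (p x) ⟩
  (𝟙 (not (p x)) + c) C suc m ∎
  where
  avoids : List _ → ℕ
  avoids ys = 𝟙 (not (any p ys))
  c = ∑[ y ∈ xs ] 𝟙 (not (p y))
  by-head : ∀ b → ∑[ ys ∈ choose m xs ] 𝟙 (not (b ∨ any p ys)) + c C suc m ≡ (𝟙 (not b) + c) C suc m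
  by-head true  = cong (_+ c C suc m) (∑-zero (choose m xs))
  by-head false = trans (cong (_+ c C suc m) (∑-choose-avoiding p m xs)) (nCk+nC[k+1]≡[n+1]C[k+1] c m)

select : List A → List (A × List A)
select []       = []
select (x ∷ xs) = (x , xs) ∷ map (map₂ (x ∷_)) (select xs)

length-select : (xs : List A) → length (select xs) ≡ length xs
length-select []       = refl
length-select (x ∷ xs) = cong suc (trans (length-map _ (select xs)) (length-select xs))

select-↭ : (xs : List A) → All (λ p → proj₁ p ∷ proj₂ p ↭ xs) (select xs)
select-↭ []       = []
select-↭ (x ∷ xs) = ↭-refl ∷ map⁺ (All.map (λ y∷ys↭xs → ↭-trans (↭-swap _ x ↭-refl) (↭-prep x y∷ys↭xs)) (select-↭ xs))

endingWith : (List A → ℕ) → A × List A → ℕ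
endingWith F (y , ys) = ∑[ zs ∈ perms ys ] F (zs ++ [ y ])

∑-insertions-snoc : (F : List A → ℕ) (x y : A) (zs : List A) →
  ∑ (insertions x (zs ++ [ y ])) F ≡ ∑[ ws ∈ insertions x zs ] F (ws ++ [ y ]) + F ((zs ++ [ y ]) ++ [ x ])
∑-insertions-snoc F x y []       = shuffle (F (x ∷ y ∷ [])) (F (y ∷ x ∷ []))
  where
  shuffle : ∀ a b → a + (b + 0) ≡ a + 0 + b
  shuffle = solve-∀
∑-insertions-snoc F x y (z ∷ zs) = begin
  F (x ∷ z ∷ zs ++ [ y ]) + ∑ (map (z ∷_) (insertions x (zs ++ [ y ]))) F
    ≡⟨ cong (F (x ∷ z ∷ zs ++ [ y ]) +_) (∑-map F (z ∷_) (insertions x (zs ++ [ y ]))) ⟩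
  F (x ∷ z ∷ zs ++ [ y ]) + ∑[ ws ∈ insertions x (zs ++ [ y ]) ] F (z ∷ ws)
    ≡⟨ cong (F (x ∷ z ∷ zs ++ [ y ]) +_) (∑-insertions-snoc (F ∘ (z ∷_)) x y zs) ⟩
  F (x ∷ z ∷ zs ++ [ y ]) + (∑[ ws ∈ insertions x zs ] F (z ∷ ws ++ [ y ]) + F (z ∷ (zs ++ [ y ]) ++ [ x ]))
    ≡⟨ +-assoc (F (x ∷ z ∷ zs ++ [ y ])) _ _ ⟨
  F (x ∷ z ∷ zs ++ [ y ]) + ∑[ ws ∈ insertions x zs ] F (z ∷ ws ++ [ y ]) + F (z ∷ (zs ++ [ y ]) ++ [ x ])
    ≡⟨ cong (λ s → F (x ∷ z ∷ zs ++ [ y ]) + s + F (z ∷ (zs ++ [ y ]) ++ [ x ])) (∑-map (λ ws → F (ws ++ [ y ])) (z ∷_) (insertions x zs)) ⟨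
  F (x ∷ z ∷ zs ++ [ y ]) + ∑[ ws ∈ map (z ∷_) (insertions x zs) ] F (ws ++ [ y ]) + F (z ∷ (zs ++ [ y ]) ++ [ x ]) ∎

∑-perms-∷-by-last : (F : List A → ℕ) (x : A) (xs : List A) →
  ∑ (perms (x ∷ xs)) F ≡ ∑ (select (x ∷ xs)) (endingWith F)
∑-perms-∷-by-last F x []       = sym (+-identityʳ (F (x ∷ []) + 0))
∑-perms-∷-by-last F x (y ∷ ys) = begin
  ∑ (perms (x ∷ y ∷ ys)) F
    ≡⟨ ∑-concatMap F (insertions x) (perms (y ∷ ys)) ⟩
  ∑ (perms (y ∷ ys)) insertingX
    ≡⟨ ∑-perms-∷-by-last insertingX y ys ⟩
  ∑ (select (y ∷ ys)) (endingWith insertingX)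
    ≡⟨ ∑-cong (select (y ∷ ys)) split ⟩
  ∑[ p ∈ select (y ∷ ys) ] (endingWith F (map₂ (x ∷_) p) + endingWith F∷x p)
    ≡⟨ ∑-+ (endingWith F ∘ map₂ (x ∷_)) (endingWith F∷x) (select (y ∷ ys)) ⟩
  ∑[ p ∈ select (y ∷ ys) ] endingWith F (map₂ (x ∷_) p) + ∑ (select (y ∷ ys)) (endingWith F∷x)
    ≡⟨ cong₂ _+_ (∑-map (endingWith F) (map₂ (x ∷_)) (select (y ∷ ys))) (∑-perms-∷-by-last F∷x y ys) ⟨
  ∑ (map (map₂ (x ∷_)) (select (y ∷ ys))) (endingWith F) + ∑ (perms (y ∷ ys)) F∷x
    ≡⟨ +-comm _ (∑ (perms (y ∷ ys)) F∷x) ⟩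
  ∑ (select (x ∷ y ∷ ys)) (endingWith F) ∎
  where
  insertingX F∷x : List _ → ℕ
  insertingX zs = ∑ (insertions x zs) F
  F∷x zs = F (zs ++ [ x ])
  split : ∀ p → endingWith insertingX p ≡ endingWith F (map₂ (x ∷_) p) + endingWith F∷x p
  split (z , zs) = begin
    ∑[ ws ∈ perms zs ] insertingX (ws ++ [ z ])
      ≡⟨ ∑-cong (perms zs) (∑-insertions-snoc F x z) ⟩
    ∑[ ws ∈ perms zs ] (∑[ vs ∈ insertions x ws ] F (vs ++ [ z ]) + F∷x (ws ++ [ z ]))
      ≡⟨ ∑-+ _ _ (perms zs) ⟩
    ∑[ ws ∈ perms zs ] ∑[ vs ∈ insertions x ws ] F (vs ++ [ z ]) + endingWith F∷x (z , zs)
      ≡⟨ cong (_+ endingWith F∷x (z , zs)) (∑-concatMap (λ vs → F (vs ++ [ z ])) (insertions x) (perms zs)) ⟨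
    endingWith F (z , x ∷ zs) + endingWith F∷x (z , zs) ∎

∑-perms-by-last : (F : List A → ℕ) → F [] ≡ 0 → (xs : List A) →
  ∑ (perms xs) F ≡ ∑ (select xs) (endingWith F)
∑-perms-by-last F F[]≡0 []       = cong (_+ 0) F[]≡0
∑-perms-by-last F _     (x ∷ xs) = ∑-perms-∷-by-last F x xs

∑-choose-select : (Φ : A → List A → ℕ) (m : ℕ) (xs : List A) →
  ∑[ ys ∈ choose (suc m) xs ] ∑[ p ∈ select ys ] Φ (proj₁ p) (proj₂ p)
    ≡ ∑[ p ∈ select xs ] ∑ (choose m (proj₂ p)) (Φ (proj₁ p))
∑-choose-select Φ m []       = refl
∑-choose-select Φ m (x ∷ xs) = begin
  ∑ (choose (suc m) (x ∷ xs)) selected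
    ≡⟨ ∑-choose-∷ selected m x xs ⟩
  ∑[ ys ∈ choose m xs ] (Φ x ys + ∑ (map (map₂ (x ∷_)) (select ys)) Φ̃) + ∑ (choose (suc m) xs) selected
    ≡⟨ cong₂ _+_ (∑-cong (choose m xs) (λ ys → cong (Φ x ys +_) (∑-map Φ̃ (map₂ (x ∷_)) (select ys))))
                 (∑-choose-select Φ m xs) ⟩
  ∑[ ys ∈ choose m xs ] (Φ x ys + ∑[ p ∈ select ys ] Φ (proj₁ p) (x ∷ proj₂ p)) + ∑ (select xs) chosen
    ≡⟨ cong (_+ ∑ (select xs) chosen) (∑-+ (Φ x) _ (choose m xs)) ⟩
  ∑ (choose m xs) (Φ x) + ∑[ ys ∈ choose m xs ] ∑[ p ∈ select ys ] Φ (proj₁ p) (x ∷ proj₂ p) + ∑ (select xs) chosen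
    ≡⟨ +-assoc (∑ (choose m xs) (Φ x)) _ _ ⟩
  ∑ (choose m xs) (Φ x) + (∑[ ys ∈ choose m xs ] ∑[ p ∈ select ys ] Φ (proj₁ p) (x ∷ proj₂ p) + ∑ (select xs) chosen)
    ≡⟨ cong (∑ (choose m xs) (Φ x) +_) (with-x m) ⟩
  ∑ (choose m xs) (Φ x) + ∑[ p ∈ select xs ] chosen (map₂ (x ∷_) p)
    ≡⟨ cong (∑ (choose m xs) (Φ x) +_) (∑-map chosen (map₂ (x ∷_)) (select xs)) ⟨
  ∑ (select (x ∷ xs)) chosen ∎
  where
  Φ̃ : _ × List _ → ℕ
  Φ̃ p = Φ (proj₁ p) (proj₂ p)
  selected : List _ → ℕ
  selected ys = ∑ (select ys) Φ̃
  chosen : _ × List _ → ℕ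
  chosen p = ∑ (choose m (proj₂ p)) (Φ (proj₁ p))
  with-x : ∀ m → ∑[ ys ∈ choose m xs ] ∑[ p ∈ select ys ] Φ (proj₁ p) (x ∷ proj₂ p)
                   + ∑[ p ∈ select xs ] ∑ (choose m (proj₂ p)) (Φ (proj₁ p))
                 ≡ ∑[ p ∈ select xs ] ∑ (choose m (x ∷ proj₂ p)) (Φ (proj₁ p))
  with-x zero    = refl
  with-x (suc j) = begin
    ∑[ ys ∈ choose (suc j) xs ] ∑[ p ∈ select ys ] Φ (proj₁ p) (x ∷ proj₂ p)
      + ∑[ p ∈ select xs ] ∑ (choose (suc j) (proj₂ p)) (Φ (proj₁ p))
      ≡⟨ cong (_+ _) (∑-choose-select (λ y ys → Φ y (x ∷ ys)) j xs) ⟩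
    ∑[ p ∈ select xs ] ∑[ ys ∈ choose j (proj₂ p) ] Φ (proj₁ p) (x ∷ ys)
      + ∑[ p ∈ select xs ] ∑ (choose (suc j) (proj₂ p)) (Φ (proj₁ p))
      ≡⟨ ∑-+ _ _ (select xs) ⟨
    ∑[ p ∈ select xs ] (∑[ ys ∈ choose j (proj₂ p) ] Φ (proj₁ p) (x ∷ ys) + ∑ (choose (suc j) (proj₂ p)) (Φ (proj₁ p)))
      ≡⟨ ∑-cong (select xs) (λ p → ∑-choose-∷ (Φ (proj₁ p)) j x (proj₂ p)) ⟨
    ∑[ p ∈ select xs ] ∑ (choose (suc j) (x ∷ proj₂ p)) (Φ (proj₁ p)) ∎

-- Every m-subset of xs is an m-subset of the rest for exactly length xs − m of the pairs in select xs.
∑-select-choose : (g : List A → ℕ) (m : ℕ) (xs : List A) →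
  ∑[ p ∈ select xs ] ∑ (choose m (proj₂ p)) g + m * ∑ (choose m xs) g ≡ length xs * ∑ (choose m xs) g
∑-select-choose g zero    []       = refl
∑-select-choose g (suc m) []       = *-zeroʳ (suc m)
∑-select-choose g zero    (x ∷ xs) = begin
  ∑ (select (x ∷ xs)) (λ _ → g [] + 0) + 0     ≡⟨ +-identityʳ _ ⟩
  ∑ (select (x ∷ xs)) (λ _ → g [] + 0)         ≡⟨ ∑-const (g [] + 0) (select (x ∷ xs)) ⟩
  length (select (x ∷ xs)) * (g [] + 0)         ≡⟨ cong (_* (g [] + 0)) (length-select (x ∷ xs)) ⟩
  length (x ∷ xs) * (g [] + 0)                  ∎
∑-select-choose g (suc j) (x ∷ xs) = begin
  Bs + ∑ (map (map₂ (x ∷_)) (select xs)) chosen + suc j * ∑ (choose (suc j) (x ∷ xs)) g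
    ≡⟨ cong₂ (λ s t → Bs + s + suc j * t) (∑-map chosen (map₂ (x ∷_)) (select xs)) (∑-choose-∷ g j x xs) ⟩
  Bs + ∑[ p ∈ select xs ] ∑ (choose (suc j) (x ∷ proj₂ p)) g + suc j * (Aj + Bs)
    ≡⟨ cong (λ s → Bs + s + suc j * (Aj + Bs))
            (trans (∑-cong (select xs) (λ p → ∑-choose-∷ g j x (proj₂ p))) (∑-+ _ _ (select xs))) ⟩
  Bs + (sel-j + sel-sj) + suc j * (Aj + Bs)
    ≡⟨ regroup sel-j sel-sj Aj Bs j ⟩
  (sel-j + j * Aj) + (sel-sj + suc j * Bs) + (Aj + Bs)
    ≡⟨ cong₂ (λ s t → s + t + (Aj + Bs)) (∑-select-choose (g ∘ (x ∷_)) j xs) (∑-select-choose g (suc j) xs) ⟩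
  length xs * Aj + length xs * Bs + (Aj + Bs)
    ≡⟨ collect (length xs) Aj Bs ⟩
  suc (length xs) * (Aj + Bs)
    ≡⟨ cong (suc (length xs) *_) (∑-choose-∷ g j x xs) ⟨
  suc (length xs) * ∑ (choose (suc j) (x ∷ xs)) g ∎
  where
  chosen : _ × List _ → ℕ
  chosen p = ∑ (choose (suc j) (proj₂ p)) g
  Aj = ∑[ ys ∈ choose j xs ] g (x ∷ ys)
  Bs = ∑ (choose (suc j) xs) g
  sel-j  = ∑[ p ∈ select xs ] ∑[ ys ∈ choose j (proj₂ p) ] g (x ∷ ys)
  sel-sj = ∑ (select xs) chosen
  regroup : ∀ a b c d j → d + (a + b) + suc j * (c + d) ≡ (a + j * c) + (b + suc j * d) + (c + d)
  regroup = solve-∀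
  collect : ∀ n c d → n * c + n * d + (c + d) ≡ suc n * (c + d)
  collect = solve-∀

-- Binomial coefficients

C-absorption : (M m : ℕ) → suc m * (M C suc m) + m * (M C m) ≡ M * (M C m)
C-absorption zero    zero    = refl
C-absorption zero    (suc m) = cong₂ _+_ (*-zeroʳ (suc (suc m))) (*-zeroʳ (suc m))
C-absorption (suc M) zero    = trans (cong (λ c → 1 * c + 0) (nC1≡n (suc M))) (tidy (suc M))
  where
  tidy : ∀ a → 1 * a + 0 ≡ a * 1
  tidy = solve-∀
C-absorption (suc M) (suc j) = begin
  suc (suc j) * (suc M C suc (suc j)) + suc j * (suc M C suc j)
    ≡⟨ cong₂ (λ s t → suc (suc j) * s + suc j * t) (pascal (suc j)) (pascal j) ⟨
  suc (suc j) * (b₁ + b₂) + suc j * (b₀ + b₁)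
    ≡⟨ regroup j b₀ b₁ b₂ ⟩
  (suc (suc j) * b₂ + suc j * b₁) + (suc j * b₁ + j * b₀) + (b₀ + b₁)
    ≡⟨ cong₂ (λ s t → s + t + (b₀ + b₁)) (C-absorption M (suc j)) (C-absorption M j) ⟩
  M * b₁ + M * b₀ + (b₀ + b₁)
    ≡⟨ collect M b₀ b₁ ⟩
  suc M * (b₀ + b₁)
    ≡⟨ cong (suc M *_) (pascal j) ⟩
  suc M * (suc M C suc j) ∎
  where
  pascal = nCk+nC[k+1]≡[n+1]C[k+1] M
  b₀ = M C j
  b₁ = M C suc j
  b₂ = M C suc (suc j)
  regroup : ∀ j b₀ b₁ b₂ → suc (suc j) * (b₁ + b₂) + suc j * (b₀ + b₁)
                          ≡ (suc (suc j) * b₂ + suc j * b₁) + (suc j * b₁ + j * b₀) + (b₀ + b₁)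
  regroup = solve-∀
  collect : ∀ M b₀ b₁ → M * b₁ + M * b₀ + (b₀ + b₁) ≡ suc M * (b₀ + b₁)
  collect = solve-∀

nCk*k!*[n∸k]!≡n! : ∀ {n k} → k ≤ n → (n C k) * (k ! * (n ∸ k) !) ≡ n !
nCk*k!*[n∸k]!≡n! {n} {k} k≤n =
  trans (cong (_* (k ! * (n ∸ k) !)) (nCk≡n!/k![n-k]! k≤n)) (m/n*n≡m {{k !* (n ∸ k) !≢0}} (k![n∸k]!∣n! k≤n))

private
  C-trinomial-factorials : ∀ {N k m} → m + k ≤ N →
    ((N ∸ k) C m) * (N C k) * (k ! * m ! * (N ∸ (k + m)) !) ≡ N !
  C-trinomial-factorials {N} {k} {m} m+k≤N = begin
    ((N ∸ k) C m) * (N C k) * (k ! * m ! * (N ∸ (k + m)) !)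
      ≡⟨ cong (λ r → ((N ∸ k) C m) * (N C k) * (k ! * m ! * r !)) (∸-+-assoc N k m) ⟨
    ((N ∸ k) C m) * (N C k) * (k ! * m ! * (N ∸ k ∸ m) !)
      ≡⟨ regroup ((N ∸ k) C m) (N C k) (k !) (m !) ((N ∸ k ∸ m) !) ⟩
    (N C k) * (k ! * (((N ∸ k) C m) * (m ! * (N ∸ k ∸ m) !)))
      ≡⟨ cong (λ t → (N C k) * (k ! * t)) (nCk*k!*[n∸k]!≡n! (m+n≤o⇒m≤o∸n m m+k≤N)) ⟩
    (N C k) * (k ! * (N ∸ k) !)
      ≡⟨ nCk*k!*[n∸k]!≡n! (≤-trans (m≤n+m k m) m+k≤N) ⟩
    N ! ∎
    where
    regroup : ∀ a b c d e → a * b * (c * d * e) ≡ b * (c * (a * (d * e)))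
    regroup = solve-∀

  C-trinomial-vanishes : ∀ N k m → ¬ (m + k ≤ N) → ((N ∸ k) C m) * (N C k) ≡ 0
  C-trinomial-vanishes N k m m+k≰N with k ≤? N
  ... | yes k≤N = cong (_* (N C k)) (k>n⇒nCk≡0 {N ∸ k} {m} (subst ((N ∸ k) <_) (m+n∸n≡m m k) (∸-monoˡ-< (≰⇒> m+k≰N) k≤N)))
  ... | no  k≰N = trans (cong (((N ∸ k) C m) *_) (k>n⇒nCk≡0 {N} {k} (≰⇒> k≰N))) (*-zeroʳ ((N ∸ k) C m))

C-trinomial : (N k m : ℕ) → ((N ∸ k) C m) * (N C k) ≡ (N C m) * ((N ∸ m) C k)
C-trinomial N k m with m + k ≤? N
... | yes m+k≤N = *-cancelʳ-≡ _ _ (k ! * m ! * (N ∸ (k + m)) !) {{nonZero}} (begin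
  ((N ∸ k) C m) * (N C k) * (k ! * m ! * (N ∸ (k + m)) !)  ≡⟨ C-trinomial-factorials {N} {k} {m} m+k≤N ⟩
  N !                                                       ≡⟨ C-trinomial-factorials {N} {m} {k} (subst (_≤ N) (+-comm m k) m+k≤N) ⟨
  ((N ∸ m) C k) * (N C m) * (m ! * k ! * (N ∸ (m + k)) !)  ≡⟨ cong₂ _*_ (*-comm ((N ∸ m) C k) (N C m)) same-factorials ⟩
  (N C m) * ((N ∸ m) C k) * (k ! * m ! * (N ∸ (k + m)) !)  ∎)
  where
  nonZero = m*n≢0 (k ! * m !) ((N ∸ (k + m)) !) {{k !* m !≢0}} {{(N ∸ (k + m)) !≢0}}
  same-factorials : m ! * k ! * (N ∸ (m + k)) ! ≡ k ! * m ! * (N ∸ (k + m)) !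
  same-factorials = cong₂ _*_ (*-comm (m !) (k !)) (cong (λ s → (N ∸ s) !) (+-comm m k))
... | no  m+k≰N = trans (C-trinomial-vanishes N k m m+k≰N)
                          (sym (trans (*-comm (N C m) _) (C-trinomial-vanishes N m k (m+k≰N ∘ subst (_≤ N) (+-comm k m)))))

-- Summing a statistic over all orderings of all m-subsets

Regular : (A → A → Bool) → List A → ℕ → Set
Regular meets E k = All (λ y → ∑[ c ∈ E ] 𝟙 (meets y c) ≡ k) E

module OrderingSums {A : Set} (meets : A → A → Bool) (meets-refl : ∀ y → meets y y ≡ true)
  (f : List A → ℕ) (f-[] : f [] ≡ 0)
  (f-snoc : ∀ zs y → f (zs ++ [ y ]) ≡ f zs + 𝟙 (not (any (meets y) zs))) where

  avoiding : A → List A → ℕ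
  avoiding y zs = 𝟙 (not (any (meets y) zs))

  total : List A → ℕ
  total G = ∑ (perms G) f

  ∑total : List A → ℕ → ℕ
  ∑total E m = ∑ (choose m E) total

  complement-count : ∀ {E k} → Regular meets E k →
    All (λ p → ∑[ c ∈ proj₂ p ] 𝟙 (not (meets (proj₁ p) c)) + k ≡ length E) (select E)
  complement-count {E} {k} regular = All.map count (select-↭ E)
    where
    count : ∀ {p} → proj₁ p ∷ proj₂ p ↭ E → ∑[ c ∈ proj₂ p ] 𝟙 (not (meets (proj₁ p) c)) + k ≡ length E
    count {y , ys} y∷ys↭E = begin
      ∑[ c ∈ ys ] 𝟙 (not (meets y c)) + k
        ≡⟨ cong (_ +_) (All.head (All-resp-↭ (↭-sym y∷ys↭E) regular)) ⟨
      ∑[ c ∈ ys ] 𝟙 (not (meets y c)) + ∑[ c ∈ E ] 𝟙 (meets y c)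
        ≡⟨ cong (_ +_) (∑-↭ (𝟙 ∘ meets y) y∷ys↭E) ⟨
      ∑[ c ∈ ys ] 𝟙 (not (meets y c)) + (𝟙 (meets y y) + ∑[ c ∈ ys ] 𝟙 (meets y c))
        ≡⟨ cong (λ b → ∑[ c ∈ ys ] 𝟙 (not (meets y c)) + (𝟙 b + ∑[ c ∈ ys ] 𝟙 (meets y c))) (meets-refl y) ⟩
      ∑[ c ∈ ys ] 𝟙 (not (meets y c)) + suc (∑[ c ∈ ys ] 𝟙 (meets y c))
        ≡⟨ +-suc _ _ ⟩
      suc (∑[ c ∈ ys ] 𝟙 (not (meets y c)) + ∑[ c ∈ ys ] 𝟙 (meets y c))
        ≡⟨ cong suc (trans (+-comm (∑[ c ∈ ys ] 𝟙 (not (meets y c))) _) (∑-𝟙-split (meets y) ys)) ⟩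
      length (y ∷ ys)
        ≡⟨ ↭-length y∷ys↭E ⟩
      length E ∎

  ∑-perms-avoiding : (y : A) (G : List A) → ∑ (perms G) (avoiding y) ≡ length G ! * avoiding y G
  ∑-perms-avoiding y G = begin
    ∑ (perms G) (avoiding y)             ≡⟨ ∑-constᴬ (avoiding y G) (All.map (cong (𝟙 ∘ not) ∘ any-↭ (meets y)) (perms-↭ G)) ⟩
    length (perms G) * avoiding y G      ≡⟨ cong (_* avoiding y G) (length-perms G) ⟩
    length G ! * avoiding y G            ∎

  ∑-orderings-avoiding : (y : A) (m : ℕ) (ys : List A) →
    ∑[ G ∈ choose m ys ] ∑ (perms G) (avoiding y) ≡ m ! * ((∑[ c ∈ ys ] 𝟙 (not (meets y c))) C m)
  ∑-orderings-avoiding y m ys = begin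
    ∑[ G ∈ choose m ys ] ∑ (perms G) (avoiding y)
      ≡⟨ ∑-congᴬ (All.map (λ {G} |G|≡m → trans (∑-perms-avoiding y G) (cong (λ l → l ! * avoiding y G) |G|≡m))
                          (choose-length m ys)) ⟩
    ∑[ G ∈ choose m ys ] (m ! * avoiding y G)
      ≡⟨ ∑-*ˡ (m !) (avoiding y) (choose m ys) ⟩
    m ! * ∑ (choose m ys) (avoiding y)
      ≡⟨ cong (m ! *_) (∑-choose-avoiding (meets y) m ys) ⟩
    m ! * ((∑[ c ∈ ys ] 𝟙 (not (meets y c))) C m) ∎

  endingWith-split : (y : A) (G : List A) → endingWith f (y , G) ≡ total G + ∑ (perms G) (avoiding y)
  endingWith-split y G = trans (∑-cong (perms G) (λ zs → f-snoc zs y)) (∑-+ f (avoiding y) (perms G))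

  ∑total-suc : ∀ {E k} → Regular meets E k → ∀ m →
    ∑total E (suc m) + m * ∑total E m ≡ length E * ∑total E m + length E * (m ! * ((length E ∸ k) C m))
  ∑total-suc {E} {k} regular m = begin
    ∑total E (suc m) + m * ∑total E m
      ≡⟨ cong (_+ m * ∑total E m) by-last-element ⟩
    ∑ (select E) rest + ∑ (select E) (λ _ → avoiders-count) + m * ∑total E m
      ≡⟨ swap-last (∑ (select E) rest) _ (m * ∑total E m) ⟩
    (∑ (select E) rest + m * ∑total E m) + ∑ (select E) (λ _ → avoiders-count)
      ≡⟨ cong₂ _+_ (∑-select-choose total m E)
                   (trans (∑-const avoiders-count (select E)) (cong (_* avoiders-count) (length-select E))) ⟩
    N * ∑total E m + N * avoiders-count ∎
    where
    N = length E
    avoiders-count = m ! * ((N ∸ k) C m)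
    rest : _ × List _ → ℕ
    rest p = ∑ (choose m (proj₂ p)) total
    swap-last : ∀ a b c → a + b + c ≡ a + c + b
    swap-last = solve-∀
    avoiders : ∀ {p} → ∑[ c ∈ proj₂ p ] 𝟙 (not (meets (proj₁ p) c)) + k ≡ N →
      ∑[ G ∈ choose m (proj₂ p) ] ∑ (perms G) (avoiding (proj₁ p)) ≡ avoiders-count
    avoiders {y , ys} c+k≡N = trans (∑-orderings-avoiding y m ys)
      (cong (λ c → m ! * (c C m)) (trans (sym (m+n∸n≡m _ k)) (cong (_∸ k) c+k≡N)))
    by-last-element : ∑total E (suc m) ≡ ∑ (select E) rest + ∑ (select E) (λ _ → avoiders-count)
    by-last-element = begin
      ∑[ G ∈ choose (suc m) E ] total G
        ≡⟨ ∑-cong (choose (suc m) E) (∑-perms-by-last f f-[]) ⟩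
      ∑[ G ∈ choose (suc m) E ] ∑ (select G) (endingWith f)
        ≡⟨ ∑-choose-select (λ y G → endingWith f (y , G)) m E ⟩
      ∑[ p ∈ select E ] ∑[ G ∈ choose m (proj₂ p) ] endingWith f (proj₁ p , G)
        ≡⟨ ∑-cong (select E) (λ p → trans (∑-cong (choose m (proj₂ p)) (endingWith-split (proj₁ p)))
                                                (∑-+ total (λ G → ∑ (perms G) (avoiding (proj₁ p))) (choose m (proj₂ p)))) ⟩
      ∑[ p ∈ select E ] (∑ (choose m (proj₂ p)) total + ∑[ G ∈ choose m (proj₂ p) ] ∑ (perms G) (avoiding (proj₁ p)))
        ≡⟨ ∑-+ rest _ (select E) ⟩
      ∑ (select E) rest + ∑[ p ∈ select E ] ∑[ G ∈ choose m (proj₂ p) ] ∑ (perms G) (avoiding (proj₁ p))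
        ≡⟨ cong (∑ (select E) rest +_) (∑-congᴬ (All.map avoiders (complement-count regular))) ⟩
      ∑ (select E) rest + ∑ (select E) (λ _ → avoiders-count) ∎

  private
    -- Both sides x satisfy x + m·T = N·T for T = k·S + N·m!·b, so m·T cancels without subtraction.
    closed-form-step : ∀ k S S′ N f b b′ a a′ m →
      S′ + m * S ≡ N * S + N * (f * b) →
      suc m * b′ + m * b ≡ (N ∸ k) * b → k ≤ N →
      suc m * a′ + m * a ≡ N * a →
      k * S + N * (f * b) ≡ N * (f * a) →
      k * S′ + N * ((suc m * f) * b′) ≡ N * ((suc m * f) * a′)
    closed-form-step k S S′ N f b b′ a a′ m rec absorb-b k≤N absorb-a closed =
      +-cancelʳ-≡ (m * T) _ _ (trans lhs (sym rhs))
      where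
      T = k * S + N * (f * b)
      lhs : k * S′ + N * ((suc m * f) * b′) + m * T ≡ N * T
      lhs = begin
        k * S′ + N * ((suc m * f) * b′) + m * T               ≡⟨ e₁ k S S′ N f b b′ m ⟩
        k * (S′ + m * S) + N * f * (suc m * b′ + m * b)       ≡⟨ cong₂ (λ s t → k * s + N * f * t) rec absorb-b ⟩
        k * (N * S + N * (f * b)) + N * f * ((N ∸ k) * b)     ≡⟨ e₂ k S N f b (N ∸ k) ⟩
        N * (k * S) + N * (f * b) * ((N ∸ k) + k)             ≡⟨ cong (λ s → N * (k * S) + N * (f * b) * s) (m∸n+n≡m k≤N) ⟩
        N * (k * S) + N * (f * b) * N                         ≡⟨ e₃ k S N f b ⟩
        N * T                                                 ∎
        where
        e₁ : ∀ k S S′ N f b b′ m → k * S′ + N * ((suc m * f) * b′) + m * (k * S + N * (f * b))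
                                  ≡ k * (S′ + m * S) + N * f * (suc m * b′ + m * b)
        e₁ = solve-∀
        e₂ : ∀ k S N f b D → k * (N * S + N * (f * b)) + N * f * (D * b) ≡ N * (k * S) + N * (f * b) * (D + k)
        e₂ = solve-∀
        e₃ : ∀ k S N f b → N * (k * S) + N * (f * b) * N ≡ N * (k * S + N * (f * b))
        e₃ = solve-∀
      rhs : N * ((suc m * f) * a′) + m * T ≡ N * T
      rhs = begin
        N * ((suc m * f) * a′) + m * T             ≡⟨ cong (λ t → N * ((suc m * f) * a′) + m * t) closed ⟩
        N * ((suc m * f) * a′) + m * (N * (f * a)) ≡⟨ e₁ N f a a′ m ⟩
        N * f * (suc m * a′ + m * a)               ≡⟨ cong (N * f *_) absorb-a ⟩
        N * f * (N * a)                            ≡⟨ e₂ N f a ⟩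
        N * (N * (f * a))                          ≡⟨ cong (N *_) closed ⟨
        N * T                                      ∎
        where
        e₁ : ∀ N f a a′ m → N * ((suc m * f) * a′) + m * (N * (f * a)) ≡ N * f * (suc m * a′ + m * a)
        e₁ = solve-∀
        e₂ : ∀ N f a → N * f * (N * a) ≡ N * (N * (f * a))
        e₂ = solve-∀

  ∑total-zero : (E : List A) → ∑total E 0 ≡ 0
  ∑total-zero E = cong (λ s → s + 0 + 0) f-[]

  ∑total-closed : ∀ {E k} → Regular meets E k → ∀ m →
    k * ∑total E m + length E * (m ! * ((length E ∸ k) C m)) ≡ length E * (m ! * (length E C m))
  ∑total-closed {[]}         {k} _       m = trans (+-identityʳ _) (trans (cong (k *_) (vanishes m)) (*-zeroʳ k))
    where
    vanishes : ∀ m → ∑total [] m ≡ 0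
    vanishes zero    = ∑total-zero []
    vanishes (suc m) = refl
  ∑total-closed {E@(x ∷ _)} {k} regular = induction
    where
    N = length E
    k≤N : k ≤ N
    k≤N = subst (_≤ N) (All.head regular) (≤-trans (m≤m+n _ _) (≤-reflexive (∑-𝟙-split (meets x) E)))
    induction : ∀ m → k * ∑total E m + N * (m ! * ((N ∸ k) C m)) ≡ N * (m ! * (N C m))
    induction zero    = trans (cong (λ s → k * s + N * 1) (∑total-zero E)) (cong (_+ N * 1) (*-zeroʳ k))
    induction (suc m) = closed-form-step k (∑total E m) (∑total E (suc m)) N (m !) _ _ _ _ m
      (∑total-suc regular m) (C-absorption (N ∸ k) m) k≤N (C-absorption N m) (induction m)

  ∑total-binomial : ∀ {E k} → Regular meets E k → ∀ m →
    ∑total E m * k * (length E C k) + ((length E C m) * m !) * length E * ((length E ∸ m) C k)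
      ≡ ((length E C m) * m !) * length E * (length E C k)
  ∑total-binomial {E} {k} regular m = begin
    S * k * (N C k) + (N C m) * m ! * N * ((N ∸ m) C k)   ≡⟨ e₁ S k (N C k) (N C m) (m !) N ((N ∸ m) C k) ⟩
    S * k * (N C k) + m ! * N * ((N C m) * ((N ∸ m) C k)) ≡⟨ cong (λ t → S * k * (N C k) + m ! * N * t) (C-trinomial N k m) ⟨
    S * k * (N C k) + m ! * N * (((N ∸ k) C m) * (N C k)) ≡⟨ e₂ S k (N C k) (m !) N ((N ∸ k) C m) ⟩
    (N C k) * (k * S + N * (m ! * ((N ∸ k) C m)))         ≡⟨ cong ((N C k) *_) (∑total-closed regular m) ⟩
    (N C k) * (N * (m ! * (N C m)))                       ≡⟨ e₃ (N C k) N (m !) (N C m) ⟩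
    (N C m) * m ! * N * (N C k)                           ∎
    where
    N = length E
    S = ∑total E m
    e₁ : ∀ S k c a f N d → S * k * c + a * f * N * d ≡ S * k * c + f * N * (a * d)
    e₁ = solve-∀
    e₂ : ∀ S k c f N b → S * k * c + f * N * (b * c) ≡ c * (k * S + N * (f * b))
    e₂ = solve-∀
    e₃ : ∀ c N f a → c * (N * (f * a)) ≡ a * f * N * c
    e₃ = solve-∀

-- The forest building process

true≢false : true ≢ false
true≢false ()

∧-true : ∀ {a b} → a ∧ b ≡ true → a ≡ true × b ≡ true
∧-true {true} {true} _ = refl , refl

∨-true : ∀ a {b} → a ∨ b ≡ true → a ≡ true ⊎ b ≡ true
∨-true true  _        = inj₁ refl
∨-true false b≡true   = inj₂ b≡true

∨-false : ∀ {a b} → a ∨ b ≡ false → a ≡ false × b ≡ false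
∨-false {false} {false} _ = refl , refl

if-false : ∀ {b} {x y : A} → b ≡ false → (if b then x else y) ≡ y
if-false refl = refl

bool-ext : ∀ {a b} → (a ≡ true → b ≡ true) → (b ≡ true → a ≡ true) → a ≡ b
bool-ext {true}  {true}  _ _ = refl
bool-ext {true}  {false} a⇒b _ = sym (a⇒b refl)
bool-ext {false} {true}  _ b⇒a = b⇒a refl
bool-ext {false} {false} _ _ = refl

∑𝟙-insert : ∀ {n} (b : Fin n) (p q : Fin n → Bool) → p b ≡ false → q b ≡ true → (∀ x → x ≢ b → p x ≡ q x) →
  ∑[ x ∈ allFin n ] 𝟙 (q x) ≡ suc (∑[ x ∈ allFin n ] 𝟙 (p x))
∑𝟙-insert {suc n} zero p q pb qb agree = begin
  ∑[ x ∈ allFin (suc n) ] 𝟙 (q x)                  ≡⟨ ∑-allFin-suc (𝟙 ∘ q) ⟩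
  𝟙 (q zero) + ∑[ x ∈ allFin n ] 𝟙 (q (suc x))      ≡⟨ cong (λ b → 𝟙 b + ∑[ x ∈ allFin n ] 𝟙 (q (suc x))) qb ⟩
  suc (∑[ x ∈ allFin n ] 𝟙 (q (suc x)))            ≡⟨ cong suc (∑-cong (allFin n) (λ x → cong 𝟙 (agree (suc x) λ ()))) ⟨
  suc (∑[ x ∈ allFin n ] 𝟙 (p (suc x)))            ≡⟨ cong (λ b → suc (𝟙 b + ∑[ x ∈ allFin n ] 𝟙 (p (suc x)))) pb ⟨
  suc (𝟙 (p zero) + ∑[ x ∈ allFin n ] 𝟙 (p (suc x))) ≡⟨ cong suc (∑-allFin-suc (𝟙 ∘ p)) ⟨
  suc (∑[ x ∈ allFin (suc n) ] 𝟙 (p x))            ∎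
∑𝟙-insert {suc n} (suc b) p q pb qb agree = begin
  ∑[ x ∈ allFin (suc n) ] 𝟙 (q x)                  ≡⟨ ∑-allFin-suc (𝟙 ∘ q) ⟩
  𝟙 (q zero) + ∑[ x ∈ allFin n ] 𝟙 (q (suc x))      ≡⟨ cong₂ _+_ (cong 𝟙 (sym (agree zero λ ())))
                                                              (∑𝟙-insert b (p ∘ suc) (q ∘ suc) pb qb (λ x x≢b → agree (suc x) (x≢b ∘ Fin.suc-injective))) ⟩
  𝟙 (p zero) + suc (∑[ x ∈ allFin n ] 𝟙 (p (suc x))) ≡⟨ +-suc _ _ ⟩
  suc (𝟙 (p zero) + ∑[ x ∈ allFin n ] 𝟙 (p (suc x))) ≡⟨ cong suc (∑-allFin-suc (𝟙 ∘ p)) ⟨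
  suc (∑[ x ∈ allFin (suc n) ] 𝟙 (p x))            ∎

module _ {n : ℕ} where

  ==-refl : (x : Fin n) → (x == x) ≡ true
  ==-refl x = dec-true (x Fin.≟ x) refl

  ==-false : {x y : Fin n} → x ≢ y → (x == y) ≡ false
  ==-false {x} {y} = dec-false (x Fin.≟ y)

  ==-sound : {x y : Fin n} → (x == y) ≡ true → x ≡ y
  ==-sound {x} {y} x==y with x Fin.≟ y
  ... | yes x≡y = x≡y

  ==-≢ : {x y : Fin n} → (x == y) ≡ false → x ≢ y
  ==-≢ {x} x==y≡false refl = true≢false (trans (sym (==-refl x)) x==y≡false)

  ∑𝟙-swap : (a b : Fin n) (p q : Fin n → Bool) → p a ≡ true → q a ≡ false → p b ≡ false → q b ≡ true →
    (∀ x → x ≢ a → x ≢ b → p x ≡ q x) → ∑[ x ∈ allFin n ] 𝟙 (q x) ≡ ∑[ x ∈ allFin n ] 𝟙 (p x)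
  ∑𝟙-swap a b p q pa qa pb qb agree = trans (∑𝟙-insert b r q rb qb r≗q) (sym (∑𝟙-insert a r p ra pa r≗p))
    where
    r : Fin n → Bool
    r x = not (x == a) ∧ p x
    ra : r a ≡ false
    ra = cong (λ c → not c ∧ p a) (==-refl a)
    r≗p : ∀ x → x ≢ a → r x ≡ p x
    r≗p x x≢a = cong (λ c → not c ∧ p x) (==-false x≢a)
    b≢a : b ≢ a
    b≢a refl = true≢false (trans (sym pa) pb)
    rb : r b ≡ false
    rb = trans (r≗p b b≢a) pb
    r≗q : ∀ x → x ≢ b → r x ≡ q x
    r≗q x x≢b with x Fin.≟ a
    ... | yes refl = sym qa
    ... | no  x≢a  = agree x x≢a x≢b

  touches : Fin n → Edge n → Bool
  touches w e = (w == proj₁ e) ∨ (w == proj₂ e)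

  meets : Edge n → Edge n → Bool
  meets e c = touches (proj₁ e) c ∨ touches (proj₂ e) c

  meets-refl : (e : Edge n) → meets e e ≡ true
  meets-refl e = cong (λ b → (b ∨ (proj₁ e == proj₂ e)) ∨ touches (proj₂ e) e) (==-refl (proj₁ e))

  usedLabel : State n → Fin n → Bool
  usedLabel s x = any (λ w → covered s w ∧ (label s w == x)) (allFin n)

  #labels : State n → ℕ
  #labels s = ∑[ x ∈ allFin n ] 𝟙 (usedLabel s x)

  κ≡#labels : (B : List (Edge n)) → κ B ≡ #labels (runForest B)
  κ≡#labels B = length-filter _ (allFin n)

  usedLabel-intro : ∀ s w x → covered s w ≡ true → label s w ≡ x → usedLabel s x ≡ true
  usedLabel-intro s w x cw refl = any-intro _ (∈-allFin w) (trans (cong (_∧ _) cw) (==-refl (label s w)))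

  usedLabel-elim : ∀ s x → usedLabel s x ≡ true → Σ (Fin n) (λ w → covered s w ≡ true × label s w ≡ x)
  usedLabel-elim s x used with any-elim _ (allFin n) used
  ... | w , cw∧lw≡x with ∧-true cw∧lw≡x
  ...   | cw , lw==x = w , cw , ==-sound lw==x

  record WellLabelled (s : State n) : Set where
    field
      own-label   : ∀ w → covered s w ≡ false → label s w ≡ w
      label-owner : ∀ w w′ → covered s w ≡ false → label s w′ ≡ w → w′ ≡ w
  open WellLabelled

  keep : State n → Fin n → Fin n → State n
  keep s u v = st (λ w → covered s w ∨ (w == u) ∨ (w == v))
                  (λ w → if label s w == label s v then label s u else label s w)

  module KeepEdge (s : State n) (wl : WellLabelled s) (u v : Fin n) where

    private
      cov = covered s
      lab = label s
      s′  = keep s u v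

    uncovered-after : ∀ w → covered s′ w ≡ false → cov w ≡ false × w ≢ u × w ≢ v
    uncovered-after w uncov with ∨-false {cov w} uncov
    ... | cw , w≠u∨v with ∨-false {w == u} w≠u∨v
    ...   | w≠u , w≠v = cw , ==-≢ w≠u , ==-≢ w≠v

    stays-covered : ∀ w → cov w ≡ true → covered s′ w ≡ true
    stays-covered w cw = cong (_∨ ((w == u) ∨ (w == v))) cw

    u-covered : covered s′ u ≡ true
    u-covered = trans (cong (λ b → cov u ∨ (b ∨ (u == v))) (==-refl u)) (∨-zeroʳ (cov u))

    keeps-lab-u : label s′ u ≡ lab u
    keeps-lab-u = if-eta (lab u == lab v)

    wellLabelled : WellLabelled s′
    wellLabelled = record { own-label = own ; label-owner = owner }
      where
      own : ∀ w → covered s′ w ≡ false → label s′ w ≡ w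
      own w uncov with uncovered-after w uncov | lab w Fin.≟ lab v
      ... | cw , _ , w≢v | yes lw≡lv = ⊥-elim (w≢v (sym (label-owner wl w v cw (trans (sym lw≡lv) (own-label wl w cw)))))
      ... | cw , _ , _   | no  _     = own-label wl w cw
      owner : ∀ w w′ → covered s′ w ≡ false → label s′ w′ ≡ w → w′ ≡ w
      owner w w′ uncov lw′≡w with uncovered-after w uncov | lab w′ Fin.≟ lab v | cov u in cu
      ... | cw , _   , _ | no  _ | _     = label-owner wl w w′ cw lw′≡w
      ... | cw , w≢u , _ | yes _ | true  = ⊥-elim (w≢u (sym (label-owner wl w u cw lw′≡w)))
      ... | cw , w≢u , _ | yes _ | false = ⊥-elim (w≢u (trans (sym lw′≡w) (own-label wl u cu)))

    used-after : ∀ x → usedLabel s′ x ≡ true →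
      x ≡ lab u ⊎ Σ (Fin n) (λ w → lab w ≢ lab v × lab w ≡ x × (cov w ≡ true ⊎ w ≡ u))
    used-after x used with usedLabel-elim s′ x used
    ... | w , cw , lw with lab w Fin.≟ lab v
    ...   | yes _    = inj₁ (sym lw)
    ...   | no  lw≢lv with ∨-true (cov w) cw
    ...     | inj₁ cw′ = inj₂ (w , lw≢lv , lw , inj₁ cw′)
    ...     | inj₂ w=u∨w=v with ∨-true (w == u) w=u∨w=v
    ...       | inj₁ w=u = inj₂ (w , lw≢lv , lw , inj₂ (==-sound w=u))
    ...       | inj₂ w=v = ⊥-elim (lw≢lv (cong lab (==-sound w=v)))

    survives : ∀ x → x ≢ lab v → usedLabel s x ≡ true → usedLabel s′ x ≡ true
    survives x x≢lv used with usedLabel-elim s x used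
    ... | w , cw , refl = usedLabel-intro s′ w (lab w) (stays-covered w cw) (if-false (==-false x≢lv))

    returns : ∀ x → usedLabel s′ x ≡ true → usedLabel s x ≡ true ⊎ (cov u ≡ false × x ≡ u)
    returns x used with used-after x used | cov u in cu
    ... | inj₁ x≡lu                     | true  = inj₁ (usedLabel-intro s u x cu (sym x≡lu))
    ... | inj₁ x≡lu                     | false = inj₂ (refl , trans x≡lu (own-label wl u cu))
    ... | inj₂ (w , _ , lw , inj₁ cw)   | _     = inj₁ (usedLabel-intro s w x cw lw)
    ... | inj₂ (w , _ , lw , inj₂ refl) | true  = inj₁ (usedLabel-intro s w x cu lw)
    ... | inj₂ (w , _ , lw , inj₂ refl) | false = inj₂ (refl , trans (sym lw) (own-label wl w cu))

    returns-≢u : ∀ x → x ≢ u → usedLabel s′ x ≡ true → usedLabel s x ≡ true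
    returns-≢u x x≢u used with returns x used
    ... | inj₁ used-before = used-before
    ... | inj₂ (_ , x≡u)   = ⊥-elim (x≢u x≡u)

    not-lab-v : cov v ≡ false → ∀ x → usedLabel s x ≡ true → x ≢ lab v
    not-lab-v cv x used x≡lv with usedLabel-elim s x used
    ... | w , cw , refl =
      true≢false (trans (sym cw) (trans (cong cov (label-owner wl v w cv (trans x≡lv (own-label wl v cv)))) cv))

    u-used-after : cov u ≡ false → usedLabel s′ u ≡ true
    u-used-after cu = usedLabel-intro s′ u u u-covered (trans keeps-lab-u (own-label wl u cu))

    u-unused-before : cov u ≡ false → usedLabel s u ≡ false
    u-unused-before cu with usedLabel s u in used
    ... | false = refl
    ... | true with usedLabel-elim s u used
    ...   | w , cw , lw = ⊥-elim (true≢false (trans (sym cw) (trans (cong cov (label-owner wl u w cu lw)) cu)))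

    #labels-new : cov u ≡ false → cov v ≡ false → #labels s′ ≡ suc (#labels s)
    #labels-new cu cv = ∑𝟙-insert u (usedLabel s) (usedLabel s′) (u-unused-before cu) (u-used-after cu)
      (λ x x≢u → bool-ext (λ used → survives x (not-lab-v cv x used) used) (returns-≢u x x≢u))

    #labels-join-u : cov u ≡ true → cov v ≡ false → #labels s′ ≡ #labels s
    #labels-join-u cu cv = ∑-cong (allFin n) (λ x → cong 𝟙 (bool-ext (returned x) (λ used → survives x (not-lab-v cv x used) used)))
      where
      returned : ∀ x → usedLabel s′ x ≡ true → usedLabel s x ≡ true
      returned x used with returns x used
      ... | inj₁ used-before = used-before
      ... | inj₂ (cu′ , _)   = ⊥-elim (true≢false (trans (sym cu) cu′))

    -- The class of v is relabelled u: the label lab v disappears and the label u appears.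
    #labels-join-v : cov u ≡ false → cov v ≡ true → #labels s′ ≡ #labels s
    #labels-join-v cu cv =
      ∑𝟙-swap (lab v) u (usedLabel s) (usedLabel s′) (usedLabel-intro s v (lab v) cv refl) lv-unused-after
              (u-unused-before cu) (u-used-after cu) (λ x x≢lv x≢u → bool-ext (survives x x≢lv) (returns-≢u x x≢u))
      where
      lv-unused-after : usedLabel s′ (lab v) ≡ false
      lv-unused-after with usedLabel s′ (lab v) in used
      ... | false = refl
      ... | true with used-after (lab v) used
      ...   | inj₁ lv≡lu = ⊥-elim (true≢false (trans (sym cv) (trans (cong cov (label-owner wl u v cu (trans lv≡lu (own-label wl u cu)))) cu)))
      ...   | inj₂ (w , lw≢lv , lw≡lv , _) = ⊥-elim (lw≢lv lw≡lv)

  step-wellLabelled : ∀ s u v → WellLabelled s → WellLabelled (step s (u , v))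
  step-wellLabelled s u v wl with covered s u ∧ covered s v
  ... | true  = wl
  ... | false = KeepEdge.wellLabelled s wl u v

  step-#labels : ∀ s u v → WellLabelled s → #labels (step s (u , v)) ≡ #labels s + 𝟙 (not (covered s u ∨ covered s v))
  step-#labels s u v wl with covered s u in cu | covered s v in cv
  ... | true  | true  = sym (+-identityʳ _)
  ... | true  | false = trans (KeepEdge.#labels-join-u s wl u v cu cv) (sym (+-identityʳ _))
  ... | false | true  = trans (KeepEdge.#labels-join-v s wl u v cu cv) (sym (+-identityʳ _))
  ... | false | false = trans (KeepEdge.#labels-new s wl u v cu cv) (+-comm 1 _)

  covered-step : ∀ s u v w → covered (step s (u , v)) w ≡ (covered s w ∨ touches w (u , v))
  covered-step s u v w with covered s u in cu | covered s v in cv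
  ... | true  | true  = bool-ext (cong (_∨ touches w (u , v))) touched⇒covered
    where
    touched⇒covered : covered s w ∨ touches w (u , v) ≡ true → covered s w ≡ true
    touched⇒covered c with ∨-true (covered s w) c
    ... | inj₁ cw = cw
    ... | inj₂ t with ∨-true (w == u) t
    ...   | inj₁ w=u = subst (λ x → covered s x ≡ true) (sym (==-sound w=u)) cu
    ...   | inj₂ w=v = subst (λ x → covered s x ≡ true) (sym (==-sound w=v)) cv
  ... | true  | false = refl
  ... | false | _     = refl

  covered-run : (zs : List (Edge n)) (s : State n) (w : Fin n) →
    covered (foldl step s zs) w ≡ (covered s w ∨ any (touches w) zs)
  covered-run []       s w = sym (∨-identityʳ _)
  covered-run (e ∷ zs) s w = begin
    covered (foldl step (step s e) zs) w                   ≡⟨ covered-run zs (step s e) w ⟩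
    covered (step s e) w ∨ any (touches w) zs              ≡⟨ cong (_∨ any (touches w) zs) (covered-step s (proj₁ e) (proj₂ e) w) ⟩
    (covered s w ∨ touches w e) ∨ any (touches w) zs       ≡⟨ ∨-assoc (covered s w) _ _ ⟩
    covered s w ∨ (touches w e ∨ any (touches w) zs)       ∎

  wellLabelled-run : (zs : List (Edge n)) (s : State n) → WellLabelled s → WellLabelled (foldl step s zs)
  wellLabelled-run []       s wl = wl
  wellLabelled-run (e ∷ zs) s wl = wellLabelled-run zs (step s e) (step-wellLabelled s (proj₁ e) (proj₂ e) wl)

  wellLabelled-init : WellLabelled (initState n)
  wellLabelled-init = record { own-label = λ _ _ → refl ; label-owner = λ _ _ _ lw′≡w → lw′≡w }

  κ-[] : κ {n} [] ≡ 0
  κ-[] = trans (κ≡#labels []) (trans (∑-cong (allFin n) (cong 𝟙 ∘ unused)) (∑-zero (allFin n)))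
    where
    unused : ∀ x → usedLabel (initState n) x ≡ false
    unused x with usedLabel (initState n) x in used
    ... | false = refl
    ... | true with usedLabel-elim (initState n) x used
    ...   | _ , () , _

  κ-snoc : (zs : List (Edge n)) (y : Edge n) → κ (zs ++ [ y ]) ≡ κ zs + 𝟙 (not (any (meets y) zs))
  κ-snoc zs (u , v) = begin
    κ (zs ++ [ (u , v) ])
      ≡⟨ κ≡#labels (zs ++ [ (u , v) ]) ⟩
    #labels (runForest (zs ++ [ (u , v) ]))
      ≡⟨ cong #labels (foldl-++ step (initState n) zs [ (u , v) ]) ⟩
    #labels (step (runForest zs) (u , v))
      ≡⟨ step-#labels (runForest zs) u v (wellLabelled-run zs (initState n) wellLabelled-init) ⟩
    #labels (runForest zs) + 𝟙 (not (covered (runForest zs) u ∨ covered (runForest zs) v))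
      ≡⟨ cong₂ (λ k b → k + 𝟙 (not b)) (sym (κ≡#labels zs))
               (trans (cong₂ _∨_ (covered-run zs (initState n) u) (covered-run zs (initState n) v))
                        (sym (any-∨ (touches u) (touches v) zs))) ⟩
    κ zs + 𝟙 (not (any (meets (u , v)) zs)) ∎

-- Edges of the complete graph

-- The number of edges of K_n satisfying q (∑-allEdges), in a form suited to induction on n.
∑pairs : (n : ℕ) → (Edge n → Bool) → ℕ
∑pairs n q = ∑[ i ∈ allFin n ] ∑[ j ∈ allFin n ] (if does (toℕ i <? toℕ j) then 𝟙 (q (i , j)) else 0)

∑-allEdges : (n : ℕ) (q : Edge n → Bool) → ∑[ e ∈ allEdges n ] 𝟙 (q e) ≡ ∑pairs n q
∑-allEdges n q = trans (∑-filter _ (𝟙 ∘ q) (cartesianProduct (allFin n) (allFin n))) (∑-cartesianProduct _ (allFin n) (allFin n))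

∑pairs-suc : (n : ℕ) (q : Edge (suc n) → Bool) →
  ∑pairs (suc n) q ≡ ∑[ j ∈ allFin n ] 𝟙 (q (zero , suc j)) + ∑pairs n (λ e → q (suc (proj₁ e) , suc (proj₂ e)))
∑pairs-suc n q =
  trans (∑-allFin-suc (λ i → ∑ (allFin (suc n)) (term i)))
          (cong₂ _+_ (∑-allFin-suc (term zero)) (∑-cong (allFin n) (λ i → ∑-allFin-suc (term (suc i)))))
  where
  term : Fin (suc n) → Fin (suc n) → ℕ
  term i j = if does (toℕ i <? toℕ j) then 𝟙 (q (i , j)) else 0

∑pairs-false : (n : ℕ) → ∑pairs n (λ _ → false) ≡ 0
∑pairs-false n = trans (∑-cong (allFin n) (λ i → trans (∑-cong (allFin n) (λ j → if-eta (does (toℕ i <? toℕ j))))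
                                                            (∑-zero (allFin n))))
                         (∑-zero (allFin n))

∑-allFin-1 : (n : ℕ) → ∑ (allFin n) (λ _ → 1) ≡ n
∑-allFin-1 n = trans (∑-const 1 (allFin n)) (trans (*-identityʳ _) (length-tabulate {n = n} (λ i → i)))

∑-allFin-== : ∀ {n} (c : Fin n) → ∑[ j ∈ allFin n ] 𝟙 (c == j) ≡ 1
∑-allFin-== {suc n} zero    = trans (∑-allFin-suc {n} (λ j → 𝟙 (zero == j))) (cong suc (∑-zero (allFin n)))
∑-allFin-== {suc n} (suc c) = trans (∑-allFin-suc (λ j → 𝟙 (suc c == j))) (∑-allFin-== c)

∑-allFin-==-pair : ∀ {n} (a b : Fin n) → toℕ a < toℕ b → ∑[ j ∈ allFin n ] 𝟙 ((a == j) ∨ (b == j)) ≡ 2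
∑-allFin-==-pair {suc n} zero    (suc b) _         = trans (∑-allFin-suc (λ j → 𝟙 ((zero == j) ∨ (suc b == j)))) (cong suc (∑-allFin-== b))
∑-allFin-==-pair {suc n} (suc a) (suc b) (s≤s a<b) = trans (∑-allFin-suc (λ j → 𝟙 ((suc a == j) ∨ (suc b == j)))) (∑-allFin-==-pair a b a<b)

length-allEdges : (n : ℕ) → length (allEdges n) ≡ n C 2
length-allEdges n = trans (length-filter _ (cartesianProduct (allFin n) (allFin n)))
                   (trans (∑-cartesianProduct _ (allFin n) (allFin n)) (pairs n))
  where
  pairs : ∀ n → ∑pairs n (λ _ → true) ≡ n C 2
  pairs zero    = refl
  pairs (suc n) = begin
    ∑pairs (suc n) (λ _ → true)                 ≡⟨ ∑pairs-suc n (λ _ → true) ⟩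
    ∑ (allFin n) (λ _ → 1) + ∑pairs n (λ _ → true) ≡⟨ cong₂ _+_ (∑-allFin-1 n) (pairs n) ⟩
    n + n C 2                                   ≡⟨ cong (_+ n C 2) (nC1≡n n) ⟨
    n C 1 + n C 2                               ≡⟨ nCk+nC[k+1]≡[n+1]C[k+1] n 1 ⟩
    suc n C 2                                   ∎

degree : ∀ {n} (c : Fin n) → suc (∑pairs n (touches c)) ≡ n
degree {suc n} zero = cong suc (begin
  ∑pairs (suc n) (touches zero)                     ≡⟨ ∑pairs-suc n (touches zero) ⟩
  ∑ (allFin n) (λ _ → 1) + ∑pairs n (λ _ → false)  ≡⟨ cong₂ _+_ (∑-allFin-1 n) (∑pairs-false n) ⟩
  n + 0                                             ≡⟨ +-identityʳ n ⟩
  n                                                 ∎)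
degree {suc n} (suc c) = cong suc (begin
  ∑pairs (suc n) (touches (suc c))                  ≡⟨ ∑pairs-suc n (touches (suc c)) ⟩
  ∑[ j ∈ allFin n ] 𝟙 (c == j) + ∑pairs n (touches c) ≡⟨ cong (_+ ∑pairs n (touches c)) (∑-allFin-== c) ⟩
  suc (∑pairs n (touches c))                        ≡⟨ degree c ⟩
  n                                                 ∎)

edge-degree : ∀ {n} (a b : Fin n) → toℕ a < toℕ b → ∑pairs n (meets (a , b)) + 3 ≡ 2 * n
edge-degree {suc n} zero (suc b) _ = begin
  ∑pairs (suc n) (meets (zero , suc b)) + 3           ≡⟨ cong (_+ 3) (∑pairs-suc n (meets (zero , suc b))) ⟩
  ∑ (allFin n) (λ _ → 1) + ∑pairs n (touches b) + 3   ≡⟨ cong (λ s → s + ∑pairs n (touches b) + 3) (∑-allFin-1 n) ⟩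
  n + ∑pairs n (touches b) + 3                        ≡⟨ cong (λ s → s + ∑pairs n (touches b) + 3) (degree b) ⟨
  suc (∑pairs n (touches b)) + ∑pairs n (touches b) + 3 ≡⟨ double (∑pairs n (touches b)) ⟩
  2 * suc (suc (∑pairs n (touches b)))                ≡⟨ cong (λ s → 2 * suc s) (degree b) ⟩
  2 * suc n                                           ∎
  where
  double : ∀ d → suc d + d + 3 ≡ 2 * suc (suc d)
  double = solve-∀
edge-degree {suc n} (suc a) (suc b) (s≤s a<b) = begin
  ∑pairs (suc n) (meets (suc a , suc b)) + 3              ≡⟨ cong (_+ 3) (∑pairs-suc n (meets (suc a , suc b))) ⟩
  ∑[ j ∈ allFin n ] 𝟙 ((a == j) ∨ (b == j)) + ∑pairs n (meets (a , b)) + 3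
                                                           ≡⟨ cong (λ s → s + ∑pairs n (meets (a , b)) + 3) (∑-allFin-==-pair a b a<b) ⟩
  2 + ∑pairs n (meets (a , b)) + 3                         ≡⟨ +-assoc 2 _ 3 ⟩
  2 + (∑pairs n (meets (a , b)) + 3)                       ≡⟨ cong (2 +_) (edge-degree a b a<b) ⟩
  2 + 2 * n                                                ≡⟨ *-suc 2 n ⟨
  2 * suc n                                                ∎

-- An edge meets itself and the 2(n − 2) edges sharing exactly one endpoint with it.
allEdges-regular : (n : ℕ) → Regular meets (allEdges n) (2 * n ∸ 3)
allEdges-regular n = All.map degree-of-edge (all-filter _ (cartesianProduct (allFin n) (allFin n)))
  where
  degree-of-edge : ∀ {e} → toℕ (proj₁ e) < toℕ (proj₂ e) → ∑[ c ∈ allEdges n ] 𝟙 (meets e c) ≡ 2 * n ∸ 3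
  degree-of-edge {a , b} a<b =
    trans (∑-allEdges n (meets (a , b))) (trans (sym (m+n∸n≡m _ 3)) (cong (_∸ 3) (edge-degree a b a<b)))

module κ-Sums (n : ℕ) = OrderingSums (meets {n}) meets-refl (κ {n}) (κ-[] {n}) κ-snoc

sumκ≡∑total : (n m : ℕ) → sumκ n m ≡ κ-Sums.∑total n (allEdges n) m
sumκ≡∑total n m = trans (sum-map κ (outcomes n m)) (∑-concatMap κ perms (choose m (allEdges n)))

-- The identity holds for all n and m.
corollary6 : (n m : ℕ) → 2 ≤ n → 1 ≤ m → m ≤ n C 2 →
    sumκ n m * (2 * n ∸ 3) * ((n C 2) C (2 * n ∸ 3))
      + numOutcomes n m * (n C 2) * ((n C 2 ∸ m) C (2 * n ∸ 3))
      ≡ numOutcomes n m * (n C 2) * ((n C 2) C (2 * n ∸ 3))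
corollary6 n m _ _ _
  rewrite sumκ≡∑total n m | length-orderings (allEdges n) m | sym (length-allEdges n)
  = κ-Sums.∑total-binomial n (allEdges-regular n) m
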